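{- For every integer $n>0$, let $b=\lfloor \log_2 n\rfloor$ and $c=n+1-2^{b}$. Then $d_4(n)=(12c-6)2^{b}+d_4(c-1)$.
   Context: A P-position of the game of Nim with $k$ piles is a $k$-tuple $(p_1,\dots,p_k)$ of non-negative integers whose nim-sum $p_1\oplus\cdots\oplus p_k$ is $0$, where $\oplus$ denotes bitwise XOR. $d_k(m)$ denotes the number of P-positions with $k$ piles whose largest pile has exactly $m$ counters, for $m\ge0$ (so $d_k(0)=1$). -}

module Defs where

open import Data.Nat using (ℕ; zero; suc; _+_; _*_; _≟_; _⊔_)
open import Data.Nat.DivMod using (_/_; _%_)
open import Data.Bool using (Bool; true; false; if_then_else_)
open import Data.Fin using (Fin; toℕ)
open import Data.Vec using (Vec; foldr; map)
open import Data.List using (List; length; filter; allFin)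
open import Relation.Nullary.Decidable using (_×-dec_)

-- Bitwise XOR on ℕ, defined by recursion on binary digits.
-- The fuel argument only guarantees termination; fuel ≥ m + n suffices
-- (each step halves both arguments).
xor-fuel : ℕ → ℕ → ℕ → ℕ
xor-fuel zero    m n = 0
xor-fuel (suc f) m n =
  (if (m % 2) Data.Nat.≡ᵇ (n % 2) then 0 else 1) + 2 * xor-fuel f (m / 2) (n / 2)

infixl 6 _⊕_
_⊕_ : ℕ → ℕ → ℕ
m ⊕ n = xor-fuel (m + n) m n

nimSum : ∀ {k} → Vec ℕ k → ℕ
nimSum = foldr _ _⊕_ 0

maxPile : ∀ {k} → Vec ℕ k → ℕ
maxPile = foldr _ _⊔_ 0

tuples : (k m : ℕ) → List (Vec ℕ k)
tuples zero    m = Data.List.[ Data.Vec.[] ]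
tuples (suc k) m =
  Data.List.concatMap (λ i → Data.List.map (toℕ i Data.Vec.∷_) (tuples k m)) (allFin (suc m))

-- d k m = number of P-positions (nim-sum 0) with k piles whose largest pile is exactly m.
-- Every such tuple has all entries ≤ m, so it appears exactly once in tuples k m.
d : ℕ → ℕ → ℕ
d k m = length (filter (λ v → (nimSum v ≟ 0) ×-dec (maxPile v ≟ m)) (tuples k m))

-- Write #P k L for the number of k-pile P-positions all of whose piles are below L, so
-- that d k m = #P k (m + 1) − #P k m.  With four piles the last pile is the nim-sum of the
-- other three, hence #P 4 L = Σ_{a,b<L} r(a ⊕ b) where r(u) counts the pairs c, e < L with
-- c ⊕ e = u.  Let K = 2^b and s ≤ K.  Splitting [0, K + s) at K, the bit K does not
-- interact with the lower bits, and x ↦ v ⊕ x permutes [0, K) when v < K; so for the bound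
-- K + s, r(u) is K plus the count for the bound s when u < K, and 2s when u ≥ K.  Hence
--   #P 4 (K + s) = K³ + 6 K s² + #P 4 s.
-- Subtracting this identity at s = r from the one at s = r + 1 leaves
-- d₄(K + r) = (12 r + 6) K + d₄(r).

module Submission where

open import Data.Bool using (Bool; true; false; _xor_; _∧_; if_then_else_)
open import Data.Bool.Properties using (xor-comm; xor-assoc; xor-same; xor-identityʳ)
open import Data.Fin using (toℕ)
open import Data.List as List using (List; length; filter; allFin)
open import Data.List.Properties using (map-++; map-∘; map-cong; map-tabulate)
open import Data.Nat
  using (ℕ; zero; suc; _+_; _*_; _∸_; _^_; _≤_; _<_; z≤n; s≤s; _≟_; _<?_; _≡ᵇ_; ⌊_/2⌋; ⌈_/2⌉)
open import Data.Nat.DivMod using (_/_; _%_; [m+kn]%n≡m%n; m*n/n≡m; m*n%n≡0; +-distrib-/)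
open import Data.Nat.Induction using (<-wellFounded)
open import Data.Nat.ListAction using (sum)
open import Data.Nat.ListAction.Properties using (sum-++)
open import Data.Nat.Logarithm using (⌊log₂_⌋; ⌊log₂⌋-mono-≤; ⌊log₂[2^n]⌋≡n)
open import Data.Nat.Logarithm.Core using (⌊log2⌋)
open import Data.Nat.Properties
open import Data.Nat.Tactic.RingSolver using (solve-∀)
open import Data.Product using (_,_; _×_)
open import Data.Sum using ([_,_]′)
open import Data.Vec using (Vec; []; _∷_)
open import Data.Vec.Relation.Unary.All as All using (All; []; _∷_; all?)
open import Function using (_∘_; id)
open import Induction.WellFounded using (Acc; acc)
open import Relation.Binary.PropositionalEquality
open import Relation.Nullary using (Dec; yes; no; does; ¬_; contradiction)
open import Relation.Nullary.Decidable using (dec-true; dec-false; _×-dec_)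
open import Relation.Unary using (Pred; Decidable)

open import Defs

-- Nim-sum

bit : Bool → ℕ
bit false = 0
bit true  = 1

data Bits : ℕ → Set where
  _∷₂_ : (a : Bool) (q : ℕ) → Bits (bit a + q * 2)

bits : ∀ n → Bits n
bits zero = false ∷₂ 0
bits (suc n) with bits n
... | false ∷₂ q = true ∷₂ q
... | true  ∷₂ q = false ∷₂ suc q

∷₂-cong : ∀ {a b q r} → a ≡ b → q ≡ r → bit a + q * 2 ≡ bit b + r * 2
∷₂-cong = cong₂ (λ a q → bit a + q * 2)

∷₂≤1+n⇒≤n : ∀ a {q n} → bit a + q * 2 ≤ suc n → q ≤ n
∷₂≤1+n⇒≤n a {zero}  _ = z≤n
∷₂≤1+n⇒≤n a {suc q} p = ≤-trans (s≤s (m≤m*n q 2)) (≤-pred (≤-trans (m≤n+m (suc q * 2) (bit a)) p))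

bit-induction : (P : ℕ → Set) → P 0 → (∀ a q → P q → P (bit a + q * 2)) → ∀ n → P n
bit-induction P base step n = go n n ≤-refl
  where
  go : ∀ fuel n → n ≤ fuel → P n
  go zero       zero _ = base
  go (suc fuel) n n≤fuel with bits n
  ... | a ∷₂ q = step a q (go fuel q (∷₂≤1+n⇒≤n a n≤fuel))

xor-fuel-zero : ∀ f → xor-fuel f 0 0 ≡ 0
xor-fuel-zero zero    = refl
xor-fuel-zero (suc f) = cong (2 *_) (xor-fuel-zero f)

∷₂%2≡bit : ∀ a q → (bit a + q * 2) % 2 ≡ bit a
∷₂%2≡bit false q = m*n%n≡0 q 2
∷₂%2≡bit true  q = [m+kn]%n≡m%n 1 q 2

∷₂/2≡ : ∀ a q → (bit a + q * 2) / 2 ≡ q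
∷₂/2≡ false q = m*n/n≡m q 2
∷₂/2≡ true  q = trans (+-distrib-/ 1 (q * 2) (subst (λ r → 1 + r < 2) (sym (m*n%n≡0 q 2)) ≤-refl))
                      (m*n/n≡m q 2)

xor-fuel-∷₂ : ∀ f a b q r →
  xor-fuel (suc f) (bit a + q * 2) (bit b + r * 2) ≡ bit (a xor b) + 2 * xor-fuel f q r
xor-fuel-∷₂ f a b q r
  rewrite ∷₂%2≡bit a q | ∷₂%2≡bit b r | ∷₂/2≡ a q | ∷₂/2≡ b r =
  cong (_+ 2 * xor-fuel f q r) (lowBit a b)
  where
  lowBit : ∀ a b → (if bit a ≡ᵇ bit b then 0 else 1) ≡ bit (a xor b)
  lowBit false false = refl
  lowBit false true  = refl
  lowBit true  false = refl
  lowBit true  true  = refl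

xor-fuel-enough : ∀ {f g} m n → m + n ≤ f → m + n ≤ g → xor-fuel f m n ≡ xor-fuel g m n
xor-fuel-enough {zero}  {g}     zero zero _ _ = sym (xor-fuel-zero g)
xor-fuel-enough {suc f} {zero}  zero zero _ _ = xor-fuel-zero (suc f)
xor-fuel-enough {suc f} {suc g} m n m+n≤f m+n≤g with bits m | bits n
... | a ∷₂ q | b ∷₂ r = begin
  xor-fuel (suc f) (bit a + q * 2) (bit b + r * 2) ≡⟨ xor-fuel-∷₂ f a b q r ⟩
  bit (a xor b) + 2 * xor-fuel f q r               ≡⟨ cong (λ x → bit (a xor b) + 2 * x)
                                                         (xor-fuel-enough q r (halve m+n≤f) (halve m+n≤g)) ⟩
  bit (a xor b) + 2 * xor-fuel g q r               ≡⟨ xor-fuel-∷₂ g a b q r ⟨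
  xor-fuel (suc g) (bit a + q * 2) (bit b + r * 2) ∎
  where
  open ≡-Reasoning
  halve : ∀ {h} → (bit a + q * 2) + (bit b + r * 2) ≤ suc h → q + r ≤ h
  halve {h} p = ∷₂≤1+n⇒≤n false (≤-trans (≤-trans (≤-reflexive (*-distribʳ-+ 2 q r))
                                 (+-mono-≤ (m≤n+m (q * 2) (bit a)) (m≤n+m (r * 2) (bit b)))) p)

⊕-∷₂ : ∀ a b q r → (bit a + q * 2) ⊕ (bit b + r * 2) ≡ bit (a xor b) + (q ⊕ r) * 2
⊕-∷₂ a b q r = begin
  xor-fuel (x + y) x y                ≡⟨ xor-fuel-enough x y ≤-refl (n≤1+n (x + y)) ⟩
  xor-fuel (suc (x + y)) x y          ≡⟨ xor-fuel-∷₂ (x + y) a b q r ⟩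
  bit (a xor b) + 2 * xor-fuel (x + y) q r
    ≡⟨ cong (bit (a xor b) +_) (*-comm 2 (xor-fuel (x + y) q r)) ⟩
  bit (a xor b) + xor-fuel (x + y) q r * 2
    ≡⟨ cong (λ z → bit (a xor b) + z * 2) (xor-fuel-enough q r q+r≤x+y ≤-refl) ⟩
  bit (a xor b) + (q ⊕ r) * 2         ∎
  where
  open ≡-Reasoning
  x = bit a + q * 2
  y = bit b + r * 2
  q+r≤x+y : q + r ≤ x + y
  q+r≤x+y = +-mono-≤ (≤-trans (m≤m*n q 2) (m≤n+m (q * 2) (bit a)))
                     (≤-trans (m≤m*n r 2) (m≤n+m (r * 2) (bit b)))

⊕-identityʳ : ∀ x → x ⊕ 0 ≡ x
⊕-identityʳ = bit-induction _ refl λ a q ih →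
  trans (⊕-∷₂ a false q 0) (∷₂-cong (xor-identityʳ a) ih)

⊕-identityˡ : ∀ x → 0 ⊕ x ≡ x
⊕-identityˡ = bit-induction _ refl λ a q ih → trans (⊕-∷₂ false a 0 q) (∷₂-cong refl ih)

⊕-same : ∀ x → x ⊕ x ≡ 0
⊕-same = bit-induction _ refl λ a q ih → trans (⊕-∷₂ a a q q) (∷₂-cong (xor-same a) ih)

⊕-comm : ∀ x y → x ⊕ y ≡ y ⊕ x
⊕-comm = bit-induction _ (λ y → trans (⊕-identityˡ y) (sym (⊕-identityʳ y))) step
  where
  step : ∀ a q → (∀ y → q ⊕ y ≡ y ⊕ q) → ∀ y → (bit a + q * 2) ⊕ y ≡ y ⊕ (bit a + q * 2)
  step a q ih y with bits y
  ... | b ∷₂ r = trans (⊕-∷₂ a b q r) (trans (∷₂-cong (xor-comm a b) (ih r)) (sym (⊕-∷₂ b a r q)))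

⊕-assoc : ∀ x y z → (x ⊕ y) ⊕ z ≡ x ⊕ (y ⊕ z)
⊕-assoc = bit-induction _ (λ y z → trans (cong (_⊕ z) (⊕-identityˡ y)) (sym (⊕-identityˡ (y ⊕ z)))) step
  where
  step : ∀ a q → (∀ y z → (q ⊕ y) ⊕ z ≡ q ⊕ (y ⊕ z)) →
         ∀ y z → ((bit a + q * 2) ⊕ y) ⊕ z ≡ (bit a + q * 2) ⊕ (y ⊕ z)
  step a q ih y z with bits y | bits z
  ... | b ∷₂ r | c ∷₂ s = begin
    ((bit a + q * 2) ⊕ (bit b + r * 2)) ⊕ (bit c + s * 2) ≡⟨ cong (_⊕ (bit c + s * 2)) (⊕-∷₂ a b q r) ⟩
    (bit (a xor b) + (q ⊕ r) * 2) ⊕ (bit c + s * 2)       ≡⟨ ⊕-∷₂ (a xor b) c (q ⊕ r) s ⟩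
    bit ((a xor b) xor c) + ((q ⊕ r) ⊕ s) * 2             ≡⟨ ∷₂-cong (xor-assoc a b c) (ih r s) ⟩
    bit (a xor (b xor c)) + (q ⊕ (r ⊕ s)) * 2             ≡⟨ ⊕-∷₂ a (b xor c) q (r ⊕ s) ⟨
    (bit a + q * 2) ⊕ (bit (b xor c) + (r ⊕ s) * 2)       ≡⟨ cong ((bit a + q * 2) ⊕_) (⊕-∷₂ b c r s) ⟨
    (bit a + q * 2) ⊕ ((bit b + r * 2) ⊕ (bit c + s * 2)) ∎
    where open ≡-Reasoning

x⊕y≡0⇒x≡y : ∀ {x y} → x ⊕ y ≡ 0 → x ≡ y
x⊕y≡0⇒x≡y {x} {y} x⊕y≡0 = begin
  x             ≡⟨ ⊕-identityʳ x ⟨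
  x ⊕ 0         ≡⟨ cong (x ⊕_) (⊕-same y) ⟨
  x ⊕ (y ⊕ y)   ≡⟨ ⊕-assoc x y y ⟨
  (x ⊕ y) ⊕ y   ≡⟨ cong (_⊕ y) x⊕y≡0 ⟩
  0 ⊕ y         ≡⟨ ⊕-identityˡ y ⟩
  y             ∎
  where open ≡-Reasoning

∷₂<2*⇒< : ∀ a q {n} → bit a + q * 2 < 2 * n → q < n
∷₂<2*⇒< a q {n} p = *-cancelʳ-< 2 q n (begin-strict
  q * 2         ≤⟨ m≤n+m (q * 2) (bit a) ⟩
  bit a + q * 2 <⟨ p ⟩
  2 * n         ≡⟨ *-comm 2 n ⟩
  n * 2         ∎)
  where open ≤-Reasoning

<⇒∷₂<2* : ∀ a {q n} → q < n → bit a + q * 2 < 2 * n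
<⇒∷₂<2* a {q} {n} q<n = begin-strict
  bit a + q * 2 ≤⟨ +-monoˡ-≤ (q * 2) (bit≤1 a) ⟩
  1 + q * 2     <⟨ n<1+n (1 + q * 2) ⟩
  suc q * 2     ≤⟨ *-monoˡ-≤ 2 q<n ⟩
  n * 2         ≡⟨ *-comm n 2 ⟩
  2 * n         ∎
  where
  open ≤-Reasoning
  bit≤1 : ∀ a → bit a ≤ 1
  bit≤1 false = z≤n
  bit≤1 true  = s≤s z≤n

⊕-pres-<2^ : ∀ b {x y} → x < 2 ^ b → y < 2 ^ b → x ⊕ y < 2 ^ b
⊕-pres-<2^ zero    (s≤s z≤n) (s≤s z≤n) = s≤s z≤n
⊕-pres-<2^ (suc b) {x} {y} x<2^1+b y<2^1+b with bits x | bits y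
... | a ∷₂ q | c ∷₂ r = subst (_< 2 ^ suc b) (sym (⊕-∷₂ a c q r))
  (<⇒∷₂<2* (a xor c) (⊕-pres-<2^ b (∷₂<2*⇒< a q x<2^1+b) (∷₂<2*⇒< c r y<2^1+b)))

⊕-split : ∀ b {x y} t u → x < 2 ^ b → y < 2 ^ b →
          (t * 2 ^ b + x) ⊕ (u * 2 ^ b + y) ≡ (t ⊕ u) * 2 ^ b + (x ⊕ y)
⊕-split zero    t u (s≤s z≤n) (s≤s z≤n) = begin
  (t * 1 + 0) ⊕ (u * 1 + 0) ≡⟨ cong₂ _⊕_ (n*1+0≡n t) (n*1+0≡n u) ⟩
  t ⊕ u                     ≡⟨ n*1+0≡n (t ⊕ u) ⟨
  (t ⊕ u) * 1 + 0           ∎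
  where
  open ≡-Reasoning
  n*1+0≡n : ∀ n → n * 1 + 0 ≡ n
  n*1+0≡n n = trans (+-identityʳ (n * 1)) (*-identityʳ n)
⊕-split (suc b) {x} {y} t u x<2^1+b y<2^1+b with bits x | bits y
... | a ∷₂ q | c ∷₂ r = begin
  (t * (2 * K) + (bit a + q * 2)) ⊕ (u * (2 * K) + (bit c + r * 2))
    ≡⟨ cong₂ _⊕_ (lift t a q) (lift u c r) ⟩
  (bit a + (t * K + q) * 2) ⊕ (bit c + (u * K + r) * 2)
    ≡⟨ ⊕-∷₂ a c (t * K + q) (u * K + r) ⟩
  bit (a xor c) + ((t * K + q) ⊕ (u * K + r)) * 2
    ≡⟨ ∷₂-cong refl (⊕-split b t u (∷₂<2*⇒< a q x<2^1+b) (∷₂<2*⇒< c r y<2^1+b)) ⟩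
  bit (a xor c) + ((t ⊕ u) * K + (q ⊕ r)) * 2
    ≡⟨ lift (t ⊕ u) (a xor c) (q ⊕ r) ⟨
  (t ⊕ u) * (2 * K) + (bit (a xor c) + (q ⊕ r) * 2)
    ≡⟨ cong ((t ⊕ u) * (2 * K) +_) (⊕-∷₂ a c q r) ⟨
  (t ⊕ u) * (2 * K) + ((bit a + q * 2) ⊕ (bit c + r * 2))
    ∎
  where
  open ≡-Reasoning
  K = 2 ^ b
  lift : ∀ t a q → t * (2 * K) + (bit a + q * 2) ≡ bit a + (t * K + q) * 2
  lift t a q = lemma t K (bit a) q
    where
    lemma : ∀ t K i q → t * (2 * K) + (i + q * 2) ≡ i + (t * K + q) * 2
    lemma = solve-∀

[2^b+x]⊕y≡2^b+[x⊕y] : ∀ b {x y} → x < 2 ^ b → y < 2 ^ b → (2 ^ b + x) ⊕ y ≡ 2 ^ b + (x ⊕ y)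
[2^b+x]⊕y≡2^b+[x⊕y] b {x} {y} x<2^b y<2^b = begin
  (2 ^ b + x) ⊕ y                   ≡⟨ cong (_⊕ y) (cong (_+ x) (*-identityˡ (2 ^ b))) ⟨
  (1 * 2 ^ b + x) ⊕ (0 * 2 ^ b + y) ≡⟨ ⊕-split b 1 0 x<2^b y<2^b ⟩
  1 * 2 ^ b + (x ⊕ y)               ≡⟨ cong (_+ (x ⊕ y)) (*-identityˡ (2 ^ b)) ⟩
  2 ^ b + (x ⊕ y)                   ∎
  where open ≡-Reasoning

x⊕[2^b+y]≡2^b+[x⊕y] : ∀ b {x y} → x < 2 ^ b → y < 2 ^ b → x ⊕ (2 ^ b + y) ≡ 2 ^ b + (x ⊕ y)
x⊕[2^b+y]≡2^b+[x⊕y] b {x} {y} x<2^b y<2^b = begin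
  x ⊕ (2 ^ b + y)                   ≡⟨ cong (x ⊕_) (cong (_+ y) (*-identityˡ (2 ^ b))) ⟨
  (0 * 2 ^ b + x) ⊕ (1 * 2 ^ b + y) ≡⟨ ⊕-split b 0 1 x<2^b y<2^b ⟩
  1 * 2 ^ b + (x ⊕ y)               ≡⟨ cong (_+ (x ⊕ y)) (*-identityˡ (2 ^ b)) ⟩
  2 ^ b + (x ⊕ y)                   ∎
  where open ≡-Reasoning

[2^b+x]⊕[2^b+y]≡x⊕y : ∀ b {x y} → x < 2 ^ b → y < 2 ^ b → (2 ^ b + x) ⊕ (2 ^ b + y) ≡ x ⊕ y
[2^b+x]⊕[2^b+y]≡x⊕y b {x} {y} x<2^b y<2^b = begin
  (2 ^ b + x) ⊕ (2 ^ b + y)         ≡⟨ cong₂ _⊕_ (cong (_+ x) (*-identityˡ (2 ^ b)))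
                                                 (cong (_+ y) (*-identityˡ (2 ^ b))) ⟨
  (1 * 2 ^ b + x) ⊕ (1 * 2 ^ b + y) ≡⟨ ⊕-split b 1 1 x<2^b y<2^b ⟩
  x ⊕ y                             ∎
  where open ≡-Reasoning

-- Finite sums

∑< : ℕ → (ℕ → ℕ) → ℕ
∑< zero    f = 0
∑< (suc n) f = f 0 + ∑< n (λ x → f (suc x))

syntax ∑< n (λ x → e) = ∑[ x < n ] e

∑-cong : ∀ n {f g} → (∀ x → x < n → f x ≡ g x) → ∑< n f ≡ ∑< n g
∑-cong zero    f≡g = refl
∑-cong (suc n) f≡g = cong₂ _+_ (f≡g 0 (s≤s z≤n)) (∑-cong n λ x x<n → f≡g (suc x) (s≤s x<n))

∑-+ : ∀ n f g → ∑[ x < n ] (f x + g x) ≡ ∑< n f + ∑< n g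
∑-+ zero    f g = refl
∑-+ (suc n) f g = trans (cong (f 0 + g 0 +_) (∑-+ n _ _)) (+-+-comm (f 0) (g 0) (∑< n _) (∑< n _))
  where
  +-+-comm : ∀ a b c d → a + b + (c + d) ≡ a + c + (b + d)
  +-+-comm = solve-∀

∑-split : ∀ m n f → ∑< (m + n) f ≡ ∑< m f + ∑[ y < n ] f (m + y)
∑-split zero    n f = refl
∑-split (suc m) n f = trans (cong (f 0 +_) (∑-split m n _)) (sym (+-assoc (f 0) _ _))

∑-suc : ∀ n f → ∑< (suc n) f ≡ ∑< n f + f n
∑-suc zero    f = +-comm (f 0) 0
∑-suc (suc n) f = trans (cong (f 0 +_) (∑-suc n _)) (sym (+-assoc (f 0) _ _))

∑-const : ∀ n c → ∑[ _ < n ] c ≡ n * c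
∑-const zero    c = refl
∑-const (suc n) c = cong (c +_) (∑-const n c)

∑-0 : ∀ n → ∑[ _ < n ] 0 ≡ 0
∑-0 n = trans (∑-const n 0) (*-zeroʳ n)

∑-1 : ∀ n → ∑[ _ < n ] 1 ≡ n
∑-1 n = trans (∑-const n 1) (*-identityʳ n)

∑-comm : ∀ m n (f : ℕ → ℕ → ℕ) → ∑[ x < m ] ∑[ y < n ] f x y ≡ ∑[ y < n ] ∑[ x < m ] f x y
∑-comm zero    n f = sym (∑-0 n)
∑-comm (suc m) n f = trans (cong (∑< n (f 0) +_) (∑-comm m n (λ x → f (suc x))))
                           (sym (∑-+ n (f 0) (λ y → ∑[ x < m ] f (suc x) y)))

∑∑-blocks : ∀ m n (F : ℕ → ℕ → ℕ) → ∑[ a < m + n ] ∑[ b < m + n ] F a b ≡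
  (∑[ a < m ] ∑[ b < m ] F a b + ∑[ a < m ] ∑[ y < n ] F a (m + y)) +
  (∑[ y < n ] ∑[ b < m ] F (m + y) b + ∑[ y < n ] ∑[ z < n ] F (m + y) (m + z))
∑∑-blocks m n F = trans (∑-split m n _)
  (cong₂ _+_ (trans (∑-cong m λ a _ → ∑-split m n (F a)) (∑-+ m _ _))
             (trans (∑-cong n λ y _ → ∑-split m n (F (m + y))) (∑-+ n _ _)))

∑∑-const : ∀ m n c → ∑[ _ < m ] ∑[ _ < n ] c ≡ m * (n * c)
∑∑-const m n c = trans (∑-cong m λ _ _ → ∑-const n c) (∑-const m (n * c))

∑∑-+ : ∀ m n (f g : ℕ → ℕ → ℕ) → ∑[ a < m ] ∑[ b < n ] (f a b + g a b) ≡
       ∑[ a < m ] ∑[ b < n ] f a b + ∑[ a < m ] ∑[ b < n ] g a b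
∑∑-+ m n f g = trans (∑-cong m λ a _ → ∑-+ n (f a) (g a)) (∑-+ m _ _)

⟦_⟧ : ∀ {p} {P : Set p} → Dec P → ℕ
⟦ P? ⟧ = bit (does P?)

⟦⟧-yes : ∀ {p} {P : Set p} (P? : Dec P) → P → ⟦ P? ⟧ ≡ 1
⟦⟧-yes P? = cong bit ∘ dec-true P?

⟦⟧-no : ∀ {p} {P : Set p} (P? : Dec P) → ¬ P → ⟦ P? ⟧ ≡ 0
⟦⟧-no P? = cong bit ∘ dec-false P?

⟦⟧-cong : ∀ {p q} {P : Set p} {Q : Set q} (P? : Dec P) (Q? : Dec Q) →
          (P → Q) → (Q → P) → ⟦ P? ⟧ ≡ ⟦ Q? ⟧
⟦⟧-cong (yes p) Q? P→Q Q→P = sym (⟦⟧-yes Q? (P→Q p))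
⟦⟧-cong (no ¬p) Q? P→Q Q→P = sym (⟦⟧-no Q? (¬p ∘ Q→P))

⟦n+x<?n+y⟧≡⟦x<?y⟧ : ∀ n x y → ⟦ n + x <? n + y ⟧ ≡ ⟦ x <? y ⟧
⟦n+x<?n+y⟧≡⟦x<?y⟧ n x y = ⟦⟧-cong (n + x <? n + y) (x <? y) (+-cancelˡ-< n x y) (+-monoʳ-< n)

∑-⟦<?⟧ : ∀ {s n} → s ≤ n → ∑[ c < n ] ⟦ c <? s ⟧ ≡ s
∑-⟦<?⟧ {s} {n} s≤n = begin
  ∑[ c < n ] ⟦ c <? s ⟧
    ≡⟨ cong (λ m → ∑[ c < m ] ⟦ c <? s ⟧) (m+[n∸m]≡n s≤n) ⟨
  ∑[ c < s + (n ∸ s) ] ⟦ c <? s ⟧                       ≡⟨ ∑-split s (n ∸ s) _ ⟩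
  ∑[ c < s ] ⟦ c <? s ⟧ + ∑[ y < n ∸ s ] ⟦ s + y <? s ⟧
    ≡⟨ cong₂ _+_ (∑-cong s λ c c<s → ⟦⟧-yes (c <? s) c<s)
                 (∑-cong (n ∸ s) λ y _ → ⟦⟧-no (s + y <? s) (≤⇒≯ (m≤m+n s y))) ⟩
  ∑[ _ < s ] 1 + ∑[ _ < n ∸ s ] 0                       ≡⟨ cong₂ _+_ (∑-1 s) (∑-0 (n ∸ s)) ⟩
  s + 0                                                 ≡⟨ +-identityʳ s ⟩
  s                                                     ∎
  where open ≡-Reasoning

∑-⟦≟⟧ : ∀ L t → ∑[ e < L ] ⟦ e ≟ t ⟧ ≡ ⟦ t <? L ⟧
∑-⟦≟⟧ zero    t = sym (⟦⟧-no (t <? 0) λ ())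
∑-⟦≟⟧ (suc L) t = begin
  ∑[ e < suc L ] ⟦ e ≟ t ⟧        ≡⟨ ∑-suc L _ ⟩
  ∑[ e < L ] ⟦ e ≟ t ⟧ + ⟦ L ≟ t ⟧ ≡⟨ cong (_+ ⟦ L ≟ t ⟧) (∑-⟦≟⟧ L t) ⟩
  ⟦ t <? L ⟧ + ⟦ L ≟ t ⟧          ≡⟨ last (t <? L) (L ≟ t) ⟩
  ⟦ t <? suc L ⟧                  ∎
  where
  open ≡-Reasoning
  last : (t<L? : Dec (t < L)) (L≡t? : Dec (L ≡ t)) → ⟦ t<L? ⟧ + ⟦ L≡t? ⟧ ≡ ⟦ t <? suc L ⟧
  last (yes t<L) (yes refl) = contradiction t<L (<-irrefl refl)
  last (yes t<L) (no _)     = sym (⟦⟧-yes (t <? suc L) (m<n⇒m<1+n t<L))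
  last (no _)    (yes refl) = sym (⟦⟧-yes (t <? suc L) ≤-refl)
  last (no t≮L)  (no L≢t)   = sym (⟦⟧-no (t <? suc L) λ t<1+L →
    [ t≮L , L≢t ∘ sym ]′ (m<1+n⇒m<n∨m≡n t<1+L))

∑-halves : ∀ n f → ∑< (2 * n) f ≡ ∑< n f + ∑[ y < n ] f (n + y)
∑-halves n f = trans (cong (λ m → ∑< (n + m) f) (+-identityʳ n)) (∑-split n n f)

∑-⊕-invariant : ∀ b {v} f → v < 2 ^ b → ∑[ c < 2 ^ b ] f (v ⊕ c) ≡ ∑< (2 ^ b) f
∑-⊕-invariant zero    f (s≤s z≤n) = refl
∑-⊕-invariant (suc b) {v} f v<2K with v <? 2 ^ b
... | yes v<K = begin
  ∑[ c < 2 * K ] f (v ⊕ c)                                ≡⟨ ∑-halves K _ ⟩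
  ∑[ c < K ] f (v ⊕ c) + ∑[ y < K ] f (v ⊕ (K + y))
    ≡⟨ cong (∑[ c < K ] f (v ⊕ c) +_) (∑-cong K λ y y<K → cong f (x⊕[2^b+y]≡2^b+[x⊕y] b v<K y<K)) ⟩
  ∑[ c < K ] f (v ⊕ c) + ∑[ y < K ] f (K + (v ⊕ y))
    ≡⟨ cong₂ _+_ (∑-⊕-invariant b f v<K) (∑-⊕-invariant b (λ y → f (K + y)) v<K) ⟩
  ∑< K f + ∑[ y < K ] f (K + y)                           ≡⟨ ∑-halves K f ⟨
  ∑< (2 * K) f                                            ∎
  where
  open ≡-Reasoning
  K = 2 ^ b
... | no v≮K with m≤n⇒∃[o]m+o≡n (≮⇒≥ v≮K)
...   | w , refl = begin
  ∑[ c < 2 * K ] f ((K + w) ⊕ c)                          ≡⟨ ∑-halves K _ ⟩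
  ∑[ c < K ] f ((K + w) ⊕ c) + ∑[ y < K ] f ((K + w) ⊕ (K + y))
    ≡⟨ cong₂ _+_ (∑-cong K λ c c<K → cong f ([2^b+x]⊕y≡2^b+[x⊕y] b w<K c<K))
                 (∑-cong K λ y y<K → cong f ([2^b+x]⊕[2^b+y]≡x⊕y b w<K y<K)) ⟩
  ∑[ c < K ] f (K + (w ⊕ c)) + ∑[ y < K ] f (w ⊕ y)
    ≡⟨ cong₂ _+_ (∑-⊕-invariant b (λ y → f (K + y)) w<K) (∑-⊕-invariant b f w<K) ⟩
  ∑[ y < K ] f (K + y) + ∑< K f                           ≡⟨ +-comm (∑[ y < K ] f (K + y)) _ ⟩
  ∑< K f + ∑[ y < K ] f (K + y)                           ≡⟨ ∑-halves K f ⟨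
  ∑< (2 * K) f                                            ∎
  where
  open ≡-Reasoning
  K = 2 ^ b
  w<K : w < K
  w<K = +-cancelˡ-< K w K (subst (K + w <_) (cong (K +_) (+-identityʳ K)) v<2K)

-- Counting P-positions

∑ᵛ : ∀ k → ℕ → (Vec ℕ k → ℕ) → ℕ
∑ᵛ zero    L g = g []
∑ᵛ (suc k) L g = ∑[ a < L ] ∑ᵛ k L (λ v → g (a ∷ v))

∑ᵛ-cong : ∀ k L {f g} → (∀ v → All (_< L) v → f v ≡ g v) → ∑ᵛ k L f ≡ ∑ᵛ k L g
∑ᵛ-cong zero    L f≡g = f≡g [] []
∑ᵛ-cong (suc k) L f≡g = ∑-cong L λ a a<L → ∑ᵛ-cong k L λ v v<L → f≡g (a ∷ v) (a<L ∷ v<L)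

∑ᵛ-+ : ∀ k L f g → ∑ᵛ k L (λ v → f v + g v) ≡ ∑ᵛ k L f + ∑ᵛ k L g
∑ᵛ-+ zero    L f g = refl
∑ᵛ-+ (suc k) L f g = trans (∑-cong L λ a _ → ∑ᵛ-+ k L _ _) (∑-+ L _ _)

∑ᵛ-restrict : ∀ k m g → ∑ᵛ k (suc m) (λ v → ⟦ all? (_<? m) v ⟧ * g v) ≡ ∑ᵛ k m g
∑ᵛ-restrict zero    m g = +-identityʳ (g [])
∑ᵛ-restrict (suc k) m g = begin
  ∑ᵛ (suc k) (suc m) (λ v → ⟦ all? (_<? m) v ⟧ * g v)         ≡⟨ ∑-suc m _ ⟩
  ∑[ a < m ] F a + F m
    ≡⟨ cong₂ _+_ (∑-cong m λ a a<m → ∑ᵛ-cong k (suc m) λ v _ →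
                    cong (_* g (a ∷ v)) (⟦all?∷⟧ {v = v} a<m))
                 (trans (∑ᵛ-cong k (suc m) λ v _ →
                           cong (_* g (m ∷ v)) (⟦⟧-no (all? (_<? m) (m ∷ v)) m≮m))
                        (∑ᵛ-zero k)) ⟩
  ∑[ a < m ] ∑ᵛ k (suc m) (λ v → ⟦ all? (_<? m) v ⟧ * g (a ∷ v)) + 0
    ≡⟨ +-identityʳ _ ⟩
  ∑[ a < m ] ∑ᵛ k (suc m) (λ v → ⟦ all? (_<? m) v ⟧ * g (a ∷ v))
    ≡⟨ ∑-cong m (λ a _ → ∑ᵛ-restrict k m (λ v → g (a ∷ v))) ⟩
  ∑ᵛ (suc k) m g                                                  ∎
  where
  open ≡-Reasoning
  F : ℕ → ℕ
  F a = ∑ᵛ k (suc m) (λ v → ⟦ all? (_<? m) (a ∷ v) ⟧ * g (a ∷ v))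
  ⟦all?∷⟧ : ∀ {a k} {v : Vec ℕ k} → a < m → ⟦ all? (_<? m) (a ∷ v) ⟧ ≡ ⟦ all? (_<? m) v ⟧
  ⟦all?∷⟧ {a} {v = v} a<m = cong (λ t → bit (t ∧ does (all? (_<? m) v))) (dec-true (a <? m) a<m)
  m≮m : ∀ {k} {v : Vec ℕ k} → ¬ All (_< m) (m ∷ v)
  m≮m (m<m ∷ _) = <-irrefl refl m<m
  ∑ᵛ-zero : ∀ k → ∑ᵛ k (suc m) (λ _ → 0) ≡ 0
  ∑ᵛ-zero zero    = refl
  ∑ᵛ-zero (suc k) = trans (∑-cong (suc m) λ _ _ → ∑ᵛ-zero k) (∑-0 (suc m))

length-filter≡sum-⟦⟧ : ∀ {a p} {A : Set a} {P : Pred A p} (P? : Decidable P) xs →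
                       length (filter P? xs) ≡ sum (List.map (⟦_⟧ ∘ P?) xs)
length-filter≡sum-⟦⟧ P? List.[] = refl
length-filter≡sum-⟦⟧ P? (x List.∷ xs) with does (P? x)
... | true  = cong suc (length-filter≡sum-⟦⟧ P? xs)
... | false = length-filter≡sum-⟦⟧ P? xs

sum-map-concatMap : ∀ {a b} {A : Set a} {B : Set b} (g : B → ℕ) (F : A → List B) xs →
                    sum (List.map g (List.concatMap F xs)) ≡ sum (List.map (λ x → sum (List.map g (F x))) xs)
sum-map-concatMap g F List.[]        = refl
sum-map-concatMap g F (x List.∷ xs) = begin
  sum (List.map g (F x List.++ List.concatMap F xs))
    ≡⟨ cong sum (map-++ g (F x) (List.concatMap F xs)) ⟩
  sum (List.map g (F x) List.++ List.map g (List.concatMap F xs))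
    ≡⟨ sum-++ (List.map g (F x)) _ ⟩
  sum (List.map g (F x)) + sum (List.map g (List.concatMap F xs))
    ≡⟨ cong (sum (List.map g (F x)) +_) (sum-map-concatMap g F xs) ⟩
  sum (List.map g (F x)) + sum (List.map (λ x → sum (List.map g (F x))) xs) ∎
  where open ≡-Reasoning

sum-map-allFin : ∀ n h → sum (List.map (h ∘ toℕ) (allFin n)) ≡ ∑< n h
sum-map-allFin n h = trans (cong sum (map-tabulate {n = n} id (h ∘ toℕ))) (sum-tabulate n h)
  where
  sum-tabulate : ∀ n h → sum (List.tabulate {n = n} (h ∘ toℕ)) ≡ ∑< n h
  sum-tabulate zero    h = refl
  sum-tabulate (suc n) h = cong (h 0 +_) (sum-tabulate n (h ∘ suc))

sum-map-tuples : ∀ k m g → sum (List.map g (tuples k m)) ≡ ∑ᵛ k (suc m) g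
sum-map-tuples zero    m g = +-identityʳ (g [])
sum-map-tuples (suc k) m g = begin
  sum (List.map g (List.concatMap (λ i → List.map (toℕ i ∷_) (tuples k m)) (allFin (suc m))))
    ≡⟨ sum-map-concatMap g (λ i → List.map (toℕ i ∷_) (tuples k m)) (allFin (suc m)) ⟩
  sum (List.map (λ i → sum (List.map g (List.map (toℕ i ∷_) (tuples k m)))) (allFin (suc m)))
    ≡⟨ cong sum (map-cong (λ i → trans (cong sum (sym (map-∘ (tuples k m))))
                                        (sum-map-tuples k m (λ v → g (toℕ i ∷ v))))
                          (allFin (suc m))) ⟩
  sum (List.map (λ i → ∑ᵛ k (suc m) (λ v → g (toℕ i ∷ v))) (allFin (suc m)))
    ≡⟨ sum-map-allFin (suc m) (λ a → ∑ᵛ k (suc m) (λ v → g (a ∷ v))) ⟩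
  ∑ᵛ (suc k) (suc m) g ∎
  where open ≡-Reasoning

maxPile-lub : ∀ {n k} {v : Vec ℕ k} → All (_≤ n) v → maxPile v ≤ n
maxPile-lub []       = z≤n
maxPile-lub (p ∷ ps) = ⊔-lub p (maxPile-lub ps)

maxPile-< : ∀ {m k a} {v : Vec ℕ k} → All (_< m) (a ∷ v) → maxPile (a ∷ v) < m
maxPile-< (a<m ∷ [])           = ⊔-pres-<m a<m (≤-<-trans z≤n a<m)
maxPile-< (a<m ∷ ps@(_ ∷ _)) = ⊔-pres-<m a<m (maxPile-< ps)

maxPile-ub : ∀ {k} (v : Vec ℕ k) → All (_≤ maxPile v) v
maxPile-ub []      = []
maxPile-ub (a ∷ v) = m≤m⊔n a _ ∷ All.map (λ p → ≤-trans p (m≤n⊔m a _)) (maxPile-ub v)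

⟦⟧-partition : ∀ {p q r} {P : Set p} {Q : Set q} {R : Set r} (P? : Dec P) (Q? : Dec Q) (R? : Dec R) →
               (Q → ¬ R) → (¬ Q → R) → ⟦ P? ⟧ ≡ ⟦ P? ×-dec Q? ⟧ + ⟦ P? ⟧ * ⟦ R? ⟧
⟦⟧-partition (yes _) (yes q) (yes r) Q→¬R _   = contradiction r (Q→¬R q)
⟦⟧-partition (yes _) (yes _) (no _)  _    _   = refl
⟦⟧-partition (yes _) (no _)  (yes _) _    _   = refl
⟦⟧-partition (yes _) (no ¬q) (no ¬r) _    ¬Q→R = contradiction (¬Q→R ¬q) ¬r
⟦⟧-partition (no _)  _       _       _    _   = refl

#P : ℕ → ℕ → ℕ
#P k L = ∑ᵛ k L (λ v → ⟦ nimSum v ≟ 0 ⟧)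

d+#P≡#P : ∀ k m → d (suc k) m + #P (suc k) m ≡ #P (suc k) (suc m)
d+#P≡#P k m = begin
  d (suc k) m + #P (suc k) m
    ≡⟨ cong₂ _+_ (trans (length-filter≡sum-⟦⟧ P-max≡m? (tuples (suc k) m)) (sum-map-tuples (suc k) m _))
                 (sym (∑ᵛ-restrict (suc k) m (λ v → ⟦ nimSum v ≟ 0 ⟧))) ⟩
  ∑ᵛ (suc k) (suc m) (⟦_⟧ ∘ P-max≡m?) +
  ∑ᵛ (suc k) (suc m) (λ v → ⟦ all? (_<? m) v ⟧ * ⟦ nimSum v ≟ 0 ⟧)
    ≡⟨ ∑ᵛ-+ (suc k) (suc m) (⟦_⟧ ∘ P-max≡m?) (λ v → ⟦ all? (_<? m) v ⟧ * ⟦ nimSum v ≟ 0 ⟧) ⟨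
  ∑ᵛ (suc k) (suc m) (λ v → ⟦ P-max≡m? v ⟧ + ⟦ all? (_<? m) v ⟧ * ⟦ nimSum v ≟ 0 ⟧)
    ≡⟨ ∑ᵛ-cong (suc k) (suc m) partition ⟨
  #P (suc k) (suc m) ∎
  where
  open ≡-Reasoning
  P-max≡m? : (v : Vec ℕ (suc k)) → Dec (nimSum v ≡ 0 × maxPile v ≡ m)
  P-max≡m? v = (nimSum v ≟ 0) ×-dec (maxPile v ≟ m)
  partition : ∀ v → All (_< suc m) v →
              ⟦ nimSum v ≟ 0 ⟧ ≡ ⟦ P-max≡m? v ⟧ + ⟦ all? (_<? m) v ⟧ * ⟦ nimSum v ≟ 0 ⟧
  partition v@(_ ∷ _) v≤m =
    trans (⟦⟧-partition (nimSum v ≟ 0) (maxPile v ≟ m) (all? (_<? m) v) max≡m⇒¬v<m max≢m⇒v<m)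
          (cong (⟦ P-max≡m? v ⟧ +_) (*-comm ⟦ nimSum v ≟ 0 ⟧ _))
    where
    max≡m⇒¬v<m : maxPile v ≡ m → ¬ All (_< m) v
    max≡m⇒¬v<m max≡m v<m = <-irrefl max≡m (maxPile-< v<m)
    max≢m⇒v<m : maxPile v ≢ m → All (_< m) v
    max≢m⇒v<m max≢m = All.map (λ x≤max → ≤-<-trans x≤max max<m) (maxPile-ub v)
      where max<m = ≤∧≢⇒< (maxPile-lub (All.map m<1+n⇒m≤n v≤m)) max≢m

-- The last pile of a P-position is the nim-sum of the others.
∑ᵛ-⟦⊕≟0⟧ : ∀ k L t →
           ∑ᵛ (suc k) L (λ v → ⟦ t ⊕ nimSum v ≟ 0 ⟧) ≡ ∑ᵛ k L (λ v → ⟦ t ⊕ nimSum v <? L ⟧)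
∑ᵛ-⟦⊕≟0⟧ zero    L t = begin
  ∑[ e < L ] ⟦ t ⊕ (e ⊕ 0) ≟ 0 ⟧
    ≡⟨ ∑-cong L (λ e _ → cong (λ x → ⟦ t ⊕ x ≟ 0 ⟧) (⊕-identityʳ e)) ⟩
  ∑[ e < L ] ⟦ t ⊕ e ≟ 0 ⟧
    ≡⟨ ∑-cong L (λ e _ → ⟦⟧-cong (t ⊕ e ≟ 0) (e ≟ t)
                               (sym ∘ x⊕y≡0⇒x≡y) λ { refl → ⊕-same t }) ⟩
  ∑[ e < L ] ⟦ e ≟ t ⟧           ≡⟨ ∑-⟦≟⟧ L t ⟩
  ⟦ t <? L ⟧                     ≡⟨ cong (λ x → ⟦ x <? L ⟧) (⊕-identityʳ t) ⟨
  ⟦ t ⊕ 0 <? L ⟧                 ∎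
  where open ≡-Reasoning
∑ᵛ-⟦⊕≟0⟧ (suc k) L t = ∑-cong L λ a _ → begin
  ∑ᵛ (suc k) L (λ v → ⟦ t ⊕ (a ⊕ nimSum v) ≟ 0 ⟧)
    ≡⟨ ∑ᵛ-cong (suc k) L (λ v _ → cong (λ x → ⟦ x ≟ 0 ⟧) (sym (⊕-assoc t a (nimSum v)))) ⟩
  ∑ᵛ (suc k) L (λ v → ⟦ (t ⊕ a) ⊕ nimSum v ≟ 0 ⟧) ≡⟨ ∑ᵛ-⟦⊕≟0⟧ k L (t ⊕ a) ⟩
  ∑ᵛ k L (λ v → ⟦ (t ⊕ a) ⊕ nimSum v <? L ⟧)
    ≡⟨ ∑ᵛ-cong k L (λ v _ → cong (λ x → ⟦ x <? L ⟧) (⊕-assoc t a (nimSum v))) ⟩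
  ∑ᵛ k L (λ v → ⟦ t ⊕ (a ⊕ nimSum v) <? L ⟧) ∎
  where open ≡-Reasoning

-- Four piles

-- Number of pairs (c , e) with c , e < L and c ⊕ e ≡ u (the partner e = u ⊕ c is forced).
r₂ : ℕ → ℕ → ℕ
r₂ L u = ∑[ c < L ] ⟦ u ⊕ c <? L ⟧

#P4≡∑∑r₂ : ∀ L → #P 4 L ≡ ∑[ a < L ] ∑[ b < L ] r₂ L (a ⊕ b)
#P4≡∑∑r₂ L = begin
  #P 4 L
    ≡⟨ ∑ᵛ-cong 4 L (λ v _ → cong (λ x → ⟦ x ≟ 0 ⟧) (⊕-identityˡ (nimSum v))) ⟨
  ∑ᵛ 4 L (λ v → ⟦ 0 ⊕ nimSum v ≟ 0 ⟧)
    ≡⟨ ∑ᵛ-⟦⊕≟0⟧ 3 L 0 ⟩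
  ∑ᵛ 3 L (λ v → ⟦ 0 ⊕ nimSum v <? L ⟧)
    ≡⟨ ∑ᵛ-cong 3 L {f = λ v → ⟦ 0 ⊕ nimSum v <? L ⟧}
                   {g = λ { (a ∷ b ∷ c ∷ []) → ⟦ (a ⊕ b) ⊕ c <? L ⟧ }}
                   (λ { (a ∷ b ∷ c ∷ []) _ → cong (λ x → ⟦ x <? L ⟧) (reassoc a b c) }) ⟩
  ∑[ a < L ] ∑[ b < L ] ∑[ c < L ] ⟦ (a ⊕ b) ⊕ c <? L ⟧
    ∎
  where
  open ≡-Reasoning
  reassoc : ∀ a b c → 0 ⊕ (a ⊕ (b ⊕ (c ⊕ 0))) ≡ (a ⊕ b) ⊕ c
  reassoc a b c = begin
    0 ⊕ (a ⊕ (b ⊕ (c ⊕ 0))) ≡⟨ ⊕-identityˡ _ ⟩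
    a ⊕ (b ⊕ (c ⊕ 0))       ≡⟨ cong (λ x → a ⊕ (b ⊕ x)) (⊕-identityʳ c) ⟩
    a ⊕ (b ⊕ c)             ≡⟨ ⊕-assoc a b c ⟨
    (a ⊕ b) ⊕ c             ∎

module _ (b : ℕ) {s : ℕ} (s≤2^b : s ≤ 2 ^ b) where
  private
    K = 2 ^ b
    L = K + s

    <s⇒<K : ∀ {y} → y < s → y < K
    <s⇒<K y<s = <-≤-trans y<s s≤2^b

  r₂-low : ∀ {u} → u < K → r₂ L u ≡ K + r₂ s u
  r₂-low {u} u<K = begin
    ∑[ c < K + s ] ⟦ u ⊕ c <? L ⟧                               ≡⟨ ∑-split K s _ ⟩
    ∑[ c < K ] ⟦ u ⊕ c <? L ⟧ + ∑[ y < s ] ⟦ u ⊕ (K + y) <? L ⟧ ≡⟨ cong₂ _+_ low high ⟩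
    ∑[ _ < K ] 1 + r₂ s u                                       ≡⟨ cong (_+ r₂ s u) (∑-1 K) ⟩
    K + r₂ s u                                                  ∎
    where
    open ≡-Reasoning
    low : ∑[ c < K ] ⟦ u ⊕ c <? L ⟧ ≡ ∑[ _ < K ] 1
    low = ∑-cong K λ c c<K → ⟦⟧-yes (u ⊕ c <? L) (<-≤-trans (⊕-pres-<2^ b u<K c<K) (m≤m+n K s))
    high : ∑[ y < s ] ⟦ u ⊕ (K + y) <? L ⟧ ≡ r₂ s u
    high = ∑-cong s λ y y<s →
      trans (cong (λ x → ⟦ x <? L ⟧) (x⊕[2^b+y]≡2^b+[x⊕y] b u<K (<s⇒<K y<s)))
            (⟦n+x<?n+y⟧≡⟦x<?y⟧ K (u ⊕ y) s)

  r₂-high : ∀ {v} → v < K → r₂ L (K + v) ≡ s + s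
  r₂-high {v} v<K = begin
    ∑[ c < K + s ] ⟦ (K + v) ⊕ c <? L ⟧                                     ≡⟨ ∑-split K s _ ⟩
    ∑[ c < K ] ⟦ (K + v) ⊕ c <? L ⟧ + ∑[ y < s ] ⟦ (K + v) ⊕ (K + y) <? L ⟧ ≡⟨ cong₂ _+_ low high ⟩
    ∑[ c < K ] ⟦ v ⊕ c <? s ⟧ + ∑[ _ < s ] 1
      ≡⟨ cong₂ _+_ (trans (∑-⊕-invariant b (λ x → ⟦ x <? s ⟧) v<K) (∑-⟦<?⟧ s≤2^b)) (∑-1 s) ⟩
    s + s                                                                   ∎
    where
    open ≡-Reasoning
    low : ∑[ c < K ] ⟦ (K + v) ⊕ c <? L ⟧ ≡ ∑[ c < K ] ⟦ v ⊕ c <? s ⟧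
    low = ∑-cong K λ c c<K →
      trans (cong (λ x → ⟦ x <? L ⟧) ([2^b+x]⊕y≡2^b+[x⊕y] b v<K c<K))
            (⟦n+x<?n+y⟧≡⟦x<?y⟧ K (v ⊕ c) s)
    high : ∑[ y < s ] ⟦ (K + v) ⊕ (K + y) <? L ⟧ ≡ ∑[ _ < s ] 1
    high = ∑-cong s λ y y<s → ⟦⟧-yes ((K + v) ⊕ (K + y) <? L)
      (subst (_< L) (sym ([2^b+x]⊕[2^b+y]≡x⊕y b v<K (<s⇒<K y<s)))
             (<-≤-trans (⊕-pres-<2^ b v<K (<s⇒<K y<s)) (m≤m+n K s)))

  ∑∑r₂-low : ∑[ a < K ] ∑[ x < K ] r₂ s (a ⊕ x) ≡ K * (s * s)
  ∑∑r₂-low = trans (∑-cong K λ a a<K → row a<K) (∑-const K (s * s))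
    where
    open ≡-Reasoning
    row : ∀ {a} → a < K → ∑[ x < K ] r₂ s (a ⊕ x) ≡ s * s
    row {a} a<K = begin
      ∑[ x < K ] ∑[ c < s ] ⟦ (a ⊕ x) ⊕ c <? s ⟧ ≡⟨ ∑-comm K s _ ⟩
      ∑[ c < s ] ∑[ x < K ] ⟦ (a ⊕ x) ⊕ c <? s ⟧ ≡⟨ ∑-cong s column ⟩
      ∑[ _ < s ] s                              ≡⟨ ∑-const s s ⟩
      s * s                                     ∎
      where
      column : ∀ c → c < s → ∑[ x < K ] ⟦ (a ⊕ x) ⊕ c <? s ⟧ ≡ s
      column c c<s = begin
        ∑[ x < K ] ⟦ (a ⊕ x) ⊕ c <? s ⟧
          ≡⟨ ∑-cong K (λ x _ → cong (λ z → ⟦ z <? s ⟧) (swap x)) ⟩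
        ∑[ x < K ] ⟦ (a ⊕ c) ⊕ x <? s ⟧
          ≡⟨ ∑-⊕-invariant b (λ z → ⟦ z <? s ⟧) (⊕-pres-<2^ b a<K (<s⇒<K c<s)) ⟩
        ∑[ x < K ] ⟦ x <? s ⟧
          ≡⟨ ∑-⟦<?⟧ s≤2^b ⟩
        s ∎
        where
        swap : ∀ x → (a ⊕ x) ⊕ c ≡ (a ⊕ c) ⊕ x
        swap x = begin
          (a ⊕ x) ⊕ c ≡⟨ ⊕-assoc a x c ⟩
          a ⊕ (x ⊕ c) ≡⟨ cong (a ⊕_) (⊕-comm x c) ⟩
          a ⊕ (c ⊕ x) ≡⟨ ⊕-assoc a c x ⟨
          (a ⊕ c) ⊕ x ∎

  #P4-recurrence : #P 4 (2 ^ b + s) ≡ 2 ^ b * (2 ^ b * 2 ^ b) + 6 * (2 ^ b * (s * s)) + #P 4 s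
  #P4-recurrence = begin
    #P 4 L                                          ≡⟨ #P4≡∑∑r₂ L ⟩
    ∑[ a < K + s ] ∑[ x < K + s ] r₂ L (a ⊕ x)      ≡⟨ ∑∑-blocks K s _ ⟩
    (∑[ a < K ] ∑[ x < K ] r₂ L (a ⊕ x) + ∑[ a < K ] ∑[ y < s ] r₂ L (a ⊕ (K + y))) +
    (∑[ y < s ] ∑[ x < K ] r₂ L ((K + y) ⊕ x) + ∑[ y < s ] ∑[ z < s ] r₂ L ((K + y) ⊕ (K + z)))
      ≡⟨ cong₂ _+_ (cong₂ _+_ low-low low-high) (cong₂ _+_ high-low high-high) ⟩
    (K * (K * K) + K * (s * s) + K * (s * (s + s))) + (s * (K * (s + s)) + (s * (s * K) + #P 4 s))
      ≡⟨ collect K s (#P 4 s) ⟩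
    K * (K * K) + 6 * (K * (s * s)) + #P 4 s        ∎
    where
    open ≡-Reasoning
    collect : ∀ K s N →
      (K * (K * K) + K * (s * s) + K * (s * (s + s))) + (s * (K * (s + s)) + (s * (s * K) + N))
      ≡ K * (K * K) + 6 * (K * (s * s)) + N
    collect = solve-∀
    low-low : ∑[ a < K ] ∑[ x < K ] r₂ L (a ⊕ x) ≡ K * (K * K) + K * (s * s)
    low-low = begin
      ∑[ a < K ] ∑[ x < K ] r₂ L (a ⊕ x)
        ≡⟨ ∑-cong K (λ a a<K → ∑-cong K λ x x<K → r₂-low (⊕-pres-<2^ b a<K x<K)) ⟩
      ∑[ a < K ] ∑[ x < K ] (K + r₂ s (a ⊕ x))
        ≡⟨ ∑∑-+ K K (λ _ _ → K) _ ⟩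
      ∑[ _ < K ] ∑[ _ < K ] K + ∑[ a < K ] ∑[ x < K ] r₂ s (a ⊕ x)
        ≡⟨ cong₂ _+_ (∑∑-const K K K) ∑∑r₂-low ⟩
      K * (K * K) + K * (s * s) ∎
    low-high : ∑[ a < K ] ∑[ y < s ] r₂ L (a ⊕ (K + y)) ≡ K * (s * (s + s))
    low-high = trans (∑-cong K λ a a<K → ∑-cong s λ y y<s →
                        trans (cong (r₂ L) (x⊕[2^b+y]≡2^b+[x⊕y] b a<K (<s⇒<K y<s)))
                              (r₂-high (⊕-pres-<2^ b a<K (<s⇒<K y<s))))
                     (∑∑-const K s (s + s))
    high-low : ∑[ y < s ] ∑[ x < K ] r₂ L ((K + y) ⊕ x) ≡ s * (K * (s + s))
    high-low = trans (∑-cong s λ y y<s → ∑-cong K λ x x<K →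
                        trans (cong (r₂ L) ([2^b+x]⊕y≡2^b+[x⊕y] b (<s⇒<K y<s) x<K))
                              (r₂-high (⊕-pres-<2^ b (<s⇒<K y<s) x<K)))
                     (∑∑-const s K (s + s))
    high-high : ∑[ y < s ] ∑[ z < s ] r₂ L ((K + y) ⊕ (K + z)) ≡ s * (s * K) + #P 4 s
    high-high = begin
      ∑[ y < s ] ∑[ z < s ] r₂ L ((K + y) ⊕ (K + z))
        ≡⟨ ∑-cong s (λ y y<s → ∑-cong s λ z z<s →
             trans (cong (r₂ L) ([2^b+x]⊕[2^b+y]≡x⊕y b (<s⇒<K y<s) (<s⇒<K z<s)))
                   (r₂-low (⊕-pres-<2^ b (<s⇒<K y<s) (<s⇒<K z<s)))) ⟩
      ∑[ y < s ] ∑[ z < s ] (K + r₂ s (y ⊕ z))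
        ≡⟨ ∑∑-+ s s (λ _ _ → K) _ ⟩
      ∑[ _ < s ] ∑[ _ < s ] K + ∑[ y < s ] ∑[ z < s ] r₂ s (y ⊕ z)
        ≡⟨ cong₂ _+_ (∑∑-const s s K) (sym (#P4≡∑∑r₂ s)) ⟩
      s * (s * K) + #P 4 s ∎

d4-recurrence : ∀ b {r} → r < 2 ^ b → d 4 (2 ^ b + r) ≡ (12 * r + 6) * 2 ^ b + d 4 r
d4-recurrence b {r} r<K = +-cancelʳ-≡ (#P 4 (K + r)) _ _ (begin
  d 4 (K + r) + #P 4 (K + r)                                   ≡⟨ d+#P≡#P 3 (K + r) ⟩
  #P 4 (suc (K + r))                                           ≡⟨ cong (#P 4) (+-suc K r) ⟨
  #P 4 (K + suc r)                                             ≡⟨ #P4-recurrence b r<K ⟩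
  K * (K * K) + 6 * (K * (suc r * suc r)) + #P 4 (suc r)
    ≡⟨ cong (K * (K * K) + 6 * (K * (suc r * suc r)) +_) (d+#P≡#P 3 r) ⟨
  K * (K * K) + 6 * (K * (suc r * suc r)) + (d 4 r + #P 4 r)   ≡⟨ expand K r (d 4 r) (#P 4 r) ⟩
  (12 * r + 6) * K + d 4 r + (K * (K * K) + 6 * (K * (r * r)) + #P 4 r)
    ≡⟨ cong ((12 * r + 6) * K + d 4 r +_) (#P4-recurrence b (<⇒≤ r<K)) ⟨
  (12 * r + 6) * K + d 4 r + #P 4 (K + r)                      ∎)
  where
  open ≡-Reasoning
  K = 2 ^ b
  expand : ∀ K r D N → K * (K * K) + 6 * (K * (suc r * suc r)) + (D + N)
                       ≡ (12 * r + 6) * K + D + (K * (K * K) + 6 * (K * (r * r)) + N)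
  expand = solve-∀

2^⌊log₂1+n⌋≤1+n : ∀ n → 2 ^ ⌊log₂ suc n ⌋ ≤ suc n
2^⌊log₂1+n⌋≤1+n n = go n (<-wellFounded (suc n))
  where
  2*⌊n/2⌋≤n : ∀ n → 2 * ⌊ n /2⌋ ≤ n
  2*⌊n/2⌋≤n n = begin
    ⌊ n /2⌋ + (⌊ n /2⌋ + 0) ≡⟨ cong (⌊ n /2⌋ +_) (+-identityʳ ⌊ n /2⌋) ⟩
    ⌊ n /2⌋ + ⌊ n /2⌋       ≤⟨ +-monoʳ-≤ ⌊ n /2⌋ (⌊n/2⌋≤⌈n/2⌉ n) ⟩
    ⌊ n /2⌋ + ⌈ n /2⌉       ≡⟨ ⌊n/2⌋+⌈n/2⌉≡n n ⟩
    n                       ∎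
    where open ≤-Reasoning
  -- ⌊log₂ n ⌋ is ⌊log2⌋ n (<-wellFounded n), so we recurse along its accessibility proof.
  go : ∀ n (rs : Acc _<_ (suc n)) → 2 ^ ⌊log2⌋ (suc n) rs ≤ suc n
  go zero    _        = ≤-refl
  go (suc n) (acc rs) = ≤-trans (*-monoʳ-≤ 2 (go ⌊ n /2⌋ (rs _))) (2*⌊n/2⌋≤n (suc (suc n)))

n<2^[1+⌊log₂n⌋] : ∀ n → n < 2 ^ suc ⌊log₂ n ⌋
n<2^[1+⌊log₂n⌋] n = ≰⇒> λ 2^[1+⌊log₂n⌋]≤n →
  1+n≰n (subst (_≤ ⌊log₂ n ⌋) (⌊log₂[2^n]⌋≡n (suc ⌊log₂ n ⌋))
                             (⌊log₂⌋-mono-≤ 2^[1+⌊log₂n⌋]≤n))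

corollary14 : (n : ℕ) →
    let b = ⌊log₂ suc n ⌋
        c = suc n + 1 ∸ 2 ^ b
    in d 4 (suc n) ≡ (12 * c ∸ 6) * 2 ^ b + d 4 (c ∸ 1)
corollary14 n = begin
  d 4 (suc n)                   ≡⟨ cong (d 4) K+r≡1+n ⟨
  d 4 (K + r)                   ≡⟨ d4-recurrence b r<K ⟩
  (12 * r + 6) * K + d 4 r      ≡⟨ cong (λ x → x * K + d 4 r) (12*[1+r]∸6≡12*r+6 r) ⟨
  (12 * suc r ∸ 6) * K + d 4 r  ≡⟨ cong (λ c → (12 * c ∸ 6) * K + d 4 (c ∸ 1)) c≡1+r ⟨
  (12 * c ∸ 6) * K + d 4 (c ∸ 1) ∎
  where
  open ≡-Reasoning
  b = ⌊log₂ suc n ⌋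
  K = 2 ^ b
  r = suc n ∸ K
  c = suc n + 1 ∸ K
  K+r≡1+n : K + r ≡ suc n
  K+r≡1+n = m+[n∸m]≡n (2^⌊log₂1+n⌋≤1+n n)
  r<K : r < K
  r<K = +-cancelˡ-< K r K
          (subst₂ _<_ (sym K+r≡1+n) (cong (K +_) (+-identityʳ K)) (n<2^[1+⌊log₂n⌋] (suc n)))
  c≡1+r : c ≡ suc r
  c≡1+r = begin
    suc n + 1 ∸ K   ≡⟨ cong (λ x → x + 1 ∸ K) K+r≡1+n ⟨
    K + r + 1 ∸ K   ≡⟨ cong (_∸ K) (+-assoc K r 1) ⟩
    K + (r + 1) ∸ K ≡⟨ m+n∸m≡n K (r + 1) ⟩
    r + 1           ≡⟨ +-comm r 1 ⟩
    suc r           ∎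
  12*[1+r]∸6≡12*r+6 : ∀ r → 12 * suc r ∸ 6 ≡ 12 * r + 6
  12*[1+r]∸6≡12*r+6 r = trans (cong (_∸ 6) (*-suc 12 r)) (trans (m+n∸m≡n 6 (6 + 12 * r)) (+-comm 6 (12 * r)))
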